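{- If $w\in S_n$ is fireworks, then $\mathrm{rajcode}(w)=\mathrm{wt}(\overline{D(w)})$.
   Context: Permutations are written in one-line notation. The decreasing runs of $w$ are the maximal blocks of consecutive positions on which $w(1)\cdots w(n)$ is decreasing; $w$ is fireworks if the first elements of its decreasing runs occur in increasing order. The Rajchgot code $\mathrm{rajcode}(w)=(r_1,\ldots,r_n)$: for each $j$ choose an increasing subsequence of $w(j),\ldots,w(n)$ containing $w(j)$ of greatest length among such subsequences; $r_j$ is the number of terms of $w(j),\ldots,w(n)$ omitted. The Rothe diagram is $D(w)=\{(i,j)\in[n]\times[n]: i<w^{ -1}(j),\ j<w(i)\}$ (box $(i,j)$ in row $i$, column $j$). For a diagram $D\subseteq[n]^2$, its upper closure is $\overline{D}=\{(i,j): i\le i' \text{ for some } (i',j)\in D\}$, and its weight $\mathrm{wt}(D)\in\mathbb{Z}^n$ has $i$th entry equal to the number of boxes of $D$ in row $i$. -}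

module Defs where

open import Data.Nat using (ℕ; suc; _∸_) renaming (_≤_ to _≤ℕ_)
open import Data.Empty using (⊥)
open import Data.Fin using (Fin; toℕ; _<_; _≤_; _<?_; _≤?_)
open import Data.Fin.Properties using (any?)
open import Data.Fin.Permutation using (Permutation′; _⟨$⟩ʳ_; _⟨$⟩ˡ_)
open import Data.List using (List; []; _∷_; length; filter; allFin)
open import Data.List.Relation.Unary.Linked using (Linked)
open import Data.Product using (Σ; ∃; _×_; _,_)
open import Relation.Binary.PropositionalEquality using (_≡_)
open import Relation.Nullary using (Dec)
open import Relation.Nullary.Decidable using (_×-dec_)

-- Conventions: w ∈ S_n is a bijection Fin n → Fin n; positions and values
-- 1..n are represented by Fin n (0-indexed), order via toℕ.

-- Position p begins a decreasing run of w iff p is the first position or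
-- w(p-1) < w(p).
RunStart : ∀ {n} → Permutation′ n → Fin n → Set
RunStart {n} w p = ∀ (q : Fin n) → suc (toℕ q) ≡ toℕ p → (w ⟨$⟩ʳ q) < (w ⟨$⟩ʳ p)

Fireworks : ∀ {n} → Permutation′ n → Set
Fireworks {n} w = ∀ (p q : Fin n) → RunStart w p → RunStart w q → p < q →
                  (w ⟨$⟩ʳ p) < (w ⟨$⟩ʳ q)

-- an increasing subsequence of w(j),...,w(n) containing (hence starting at) w(j),
-- given by its list of positions
IncStep : ∀ {n} → Permutation′ n → Fin n → Fin n → Set
IncStep w a b = (a < b) × ((w ⟨$⟩ʳ a) < (w ⟨$⟩ʳ b))

IncSubseqFrom : ∀ {n} → Permutation′ n → Fin n → List (Fin n) → Set
IncSubseqFrom w j []       = ⊥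
IncSubseqFrom w j (k ∷ ks) = (k ≡ j) × Linked (IncStep w) (k ∷ ks)

-- r is the j-th entry of rajcode(w): some increasing subsequence starting at
-- w(j) has maximal length L among such, and r = (number of terms of
-- w(j),...,w(n)) - L = (n - j) - L (0-indexed j).
IsRajcodeEntry : ∀ {n} → Permutation′ n → Fin n → ℕ → Set
IsRajcodeEntry {n} w j r =
  Σ (List (Fin n)) λ s →
    IncSubseqFrom w j s ×
    (∀ (t : List (Fin n)) → IncSubseqFrom w j t → length t ≤ℕ length s) ×
    (r ≡ (n ∸ toℕ j) ∸ length s)

InRothe : ∀ {n} → Permutation′ n → Fin n → Fin n → Set
InRothe w i j = (i < (w ⟨$⟩ˡ j)) × (j < (w ⟨$⟩ʳ i))

InUpperClosure : ∀ {n} → Permutation′ n → Fin n → Fin n → Set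
InUpperClosure w i j = ∃ λ i' → (i ≤ i') × InRothe w i' j

inUpperClosure? : ∀ {n} (w : Permutation′ n) (i j : Fin n) → Dec (InUpperClosure w i j)
inUpperClosure? w i j =
  any? (λ i' → (i ≤? i') ×-dec ((i' <? (w ⟨$⟩ˡ j)) ×-dec (j <? (w ⟨$⟩ʳ i'))))

wtUpperClosureRothe : ∀ {n} → Permutation′ n → Fin n → ℕ
wtUpperClosureRothe {n} w i = length (filter (inUpperClosure? w i) (allFin n))

{-# OPTIONS --safe #-}
module Submission where

-- For fireworks w every run start is a left-to-right maximum: the start of an earlier run
-- lies above every entry of its run and below the later start. Hence j followed by the
-- left-to-right maxima after j is an increasing subsequence, and none from j is longer:
-- along a step p → q the head of the run of q is a maximum in (p, q], so the number of
-- maxima to the right strictly drops. Dually, w(p) lies in row j of the upper closure of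
-- D(w) iff p > j and p is not a maximum, for then p is not a run start and its predecessor
-- q ≥ j gives (q, w(p)) ∈ D(w). Both sides thus equal n − j − 1 − #(maxima after j).

open import Defs
open import Data.Nat using (ℕ)
open import Data.Fin using (Fin)
open import Data.Fin.Permutation using (Permutation′)

open import Data.Nat using (zero; suc; _+_; _∸_; z≤n; s≤s; s≤s⁻¹) renaming (_≤_ to _≤ℕ_; _<_ to _<ℕ_)
import Data.Nat.Properties as ℕ
open import Data.Fin using (toℕ; inject₁; _<_; _≤_; _<?_)
open import Data.Fin.Properties using (all?; _≟_; toℕ-injective; toℕ-inject₁; ≤∧≢⇒<; ≤-refl; ≤-antisym)
open import Data.Fin.Induction using (<-wellFounded)
open import Data.Fin.Permutation using (_⟨$⟩ʳ_; inverseˡ)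
open import Data.List using (List; _∷_; length; filter; allFin; tabulate)
open import Data.List.Relation.Unary.All as All using (All; []; _∷_)
open import Data.List.Relation.Unary.All.Properties using (all-filter)
open import Data.List.Relation.Unary.AllPairs using (_∷_)
import Data.List.Relation.Unary.AllPairs.Properties as AllPairs
open import Data.List.Relation.Unary.Linked as Linked using (Linked; [-]; _∷_)
open import Data.List.Relation.Unary.Linked.Properties using (AllPairs⇒Linked)
open import Data.Product using (∃; _×_; _,_; proj₁; proj₂)
open import Data.Sum using (_⊎_; inj₁; inj₂)
open import Data.Vec.Functional using (removeAt)
open import Function using (id; _∘_)
open import Function.Bundles using (Injection)
open import Function.Properties.Inverse using (↔⇒↣)
open import Induction.WellFounded using (Acc; acc)
open import Relation.Binary.Core using (Rel)
open import Relation.Nullary using (Dec; yes; no; ¬_; contradiction)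
open import Relation.Nullary.Decidable using (_×-dec_; _→-dec_; ¬?)
open import Relation.Unary using (Pred; Decidable)
open import Relation.Binary.PropositionalEquality
open import Algebra.Properties.CommutativeMonoid.Sum ℕ.+-0-commutativeMonoid
  using (sum; sum-cong-≗; ∑-distrib-+; sum-permute; sum-remove)

indicator : ∀ {a} {A : Set a} → Dec A → ℕ
indicator (yes _) = 1
indicator (no _)  = 0

indicator-yes : ∀ {a} {A : Set a} (x : Dec A) → A → indicator x ≡ 1
indicator-yes (yes _) _ = refl
indicator-yes (no ¬a) a = contradiction a ¬a

indicator-cong : ∀ {a b} {A : Set a} {B : Set b} (x : Dec A) (y : Dec B) →
                 (A → B) → (B → A) → indicator x ≡ indicator y
indicator-cong (yes _) (yes _) _   _   = refl
indicator-cong (yes a) (no ¬b) A⇒B _   = contradiction (A⇒B a) ¬b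
indicator-cong (no ¬a) (yes b) _   B⇒A = contradiction (B⇒A b) ¬a
indicator-cong (no _)  (no _)  _   _   = refl

indicator-split : ∀ {a b} {A : Set a} {B : Set b} (x : Dec A) (y : Dec B) →
                  indicator (x ×-dec ¬? y) + indicator (x ×-dec y) ≡ indicator x
indicator-split (yes _) (yes _) = refl
indicator-split (yes _) (no _)  = refl
indicator-split (no _)  _       = refl

count : ∀ {n p} {P : Pred (Fin n) p} → Decidable P → ℕ
count P? = sum (indicator ∘ P?)

length-filter-tabulate : ∀ {a p} {A : Set a} {P : Pred A p} (P? : Decidable P) {n} (f : Fin n → A) →
                         length (filter P? (tabulate f)) ≡ count (P? ∘ f)
length-filter-tabulate P? {zero}  f = refl
length-filter-tabulate P? {suc n} f with P? (f Fin.zero)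
... | yes _ = cong suc (length-filter-tabulate P? (f ∘ Fin.suc))
... | no _  = length-filter-tabulate P? (f ∘ Fin.suc)

count-permute : ∀ {n p} {P : Pred (Fin n) p} (P? : Decidable P) (π : Permutation′ n) →
                count (P? ∘ (π ⟨$⟩ʳ_)) ≡ count P?
count-permute P? π = sym (sum-permute (indicator ∘ P?) π)

count-universal : ∀ {n p} {P : Pred (Fin n) p} (P? : Decidable P) → (∀ i → P i) → count P? ≡ n
count-universal {zero}  P? all = refl
count-universal {suc n} P? all =
  cong₂ _+_ (indicator-yes (P? Fin.zero) (all Fin.zero)) (count-universal (P? ∘ Fin.suc) (all ∘ Fin.suc))

count-witness : ∀ {n p} {P : Pred (Fin n) p} (P? : Decidable P) {i} → P i → 1 ≤ℕ count P?
count-witness {suc n} P? {i} Pi = begin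
  1                                                    ≡⟨ sym (indicator-yes (P? i) Pi) ⟩
  indicator (P? i)                                     ≤⟨ ℕ.m≤m+n _ _ ⟩
  indicator (P? i) + sum (removeAt (indicator ∘ P?) i) ≡⟨ sym (sum-remove (indicator ∘ P?)) ⟩
  count P?                                             ∎
  where open ℕ.≤-Reasoning

count-cong : ∀ {n p q} {P : Pred (Fin n) p} {Q : Pred (Fin n) q} (P? : Decidable P) (Q? : Decidable Q) →
             (∀ i → P i → Q i) → (∀ i → Q i → P i) → count P? ≡ count Q?
count-cong P? Q? P⇒Q Q⇒P = sum-cong-≗ (λ i → indicator-cong (P? i) (Q? i) (P⇒Q i) (Q⇒P i))

count-split : ∀ {n p q} {P : Pred (Fin n) p} {Q : Pred (Fin n) q} (P? : Decidable P) (Q? : Decidable Q) →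
              count (λ i → P? i ×-dec ¬? (Q? i)) + count (λ i → P? i ×-dec Q? i) ≡ count P?
count-split P? Q? = trans
  (sym (∑-distrib-+ (λ i → indicator (P? i ×-dec ¬? (Q? i))) (λ i → indicator (P? i ×-dec Q? i))))
  (sum-cong-≗ (λ i → indicator-split (P? i) (Q? i)))

count-<-mono : ∀ {n p q} {P : Pred (Fin n) p} {Q : Pred (Fin n) q} (P? : Decidable P) (Q? : Decidable Q) →
               (∀ i → P i → Q i) → ∀ {i} → Q i → ¬ P i → count P? <ℕ count Q?
count-<-mono {P = P} {Q} P? Q? P⇒Q Qi ¬Pi = begin-strict
  count P?                                                           <⟨ ℕ.n<1+n _ ⟩
  1 + count P?                                                       ≤⟨ ℕ.+-mono-≤ (count-witness Q∖P? (Qi , ¬Pi)) (ℕ.≤-reflexive P≡Q∩P) ⟩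
  count Q∖P? + count Q∩P?                                            ≡⟨ count-split Q? P? ⟩
  count Q?                                                           ∎
  where
  open ℕ.≤-Reasoning
  Q∖P? : Decidable (λ i → Q i × ¬ P i)
  Q∖P? i = Q? i ×-dec ¬? (P? i)
  Q∩P? : Decidable (λ i → Q i × P i)
  Q∩P? i = Q? i ×-dec P? i
  P≡Q∩P : count P? ≡ count Q∩P?
  P≡Q∩P = count-cong P? Q∩P? (λ i Pi → P⇒Q i Pi , Pi) (λ _ → proj₂)

count-after : ∀ {n} (j : Fin n) → count (λ (i : Fin n) → j <? i) ≡ n ∸ suc (toℕ j)
count-after {suc n} Fin.zero    = count-universal (λ (i : Fin n) → Fin.zero {n} <? Fin.suc i) (λ _ → s≤s z≤n)
count-after {suc n} (Fin.suc j) = trans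
  (count-cong (λ (i : Fin n) → Fin.suc j <? Fin.suc i) (λ i → j <? i) (λ _ → s≤s⁻¹) (λ _ → s≤s))
  (count-after j)

Linked-×-All : ∀ {a r p} {A : Set a} {R : Rel A r} {P : Pred A p} {x xs} →
               Linked R (x ∷ xs) → All P xs → Linked (λ u v → R u v × P v) (x ∷ xs)
Linked-×-All [-]      []       = [-]
Linked-×-All (r ∷ rs) (p ∷ ps) = (r , p) ∷ Linked-×-All rs ps

_⋖_ : ∀ {n} → Fin n → Fin n → Set
q ⋖ p = suc (toℕ q) ≡ toℕ p

⋖⇒< : ∀ {n} {q p : Fin n} → q ⋖ p → q < p
⋖⇒< = ℕ.≤-reflexive

⋖⇒≤ : ∀ {n} {q p x : Fin n} → q ⋖ p → x < p → x ≤ q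
⋖⇒≤ {x = x} q⋖p x<p = s≤s⁻¹ (subst (suc (toℕ x) ≤ℕ_) (sym q⋖p) x<p)

runStart⊎descent : ∀ {n} (w : Permutation′ n) p →
                   RunStart w p ⊎ ∃ λ q → q ⋖ p × (w ⟨$⟩ʳ p) < (w ⟨$⟩ʳ q)
runStart⊎descent w Fin.zero    = inj₁ (λ _ ())
runStart⊎descent w (Fin.suc p) with (w ⟨$⟩ʳ inject₁ p) <? (w ⟨$⟩ʳ Fin.suc p)
... | yes ascent  = inj₁ λ q q⋖p →
  subst (λ r → (w ⟨$⟩ʳ r) < (w ⟨$⟩ʳ Fin.suc p)) (sym (toℕ-injective (trans (ℕ.suc-injective q⋖p) (sym (toℕ-inject₁ p))))) ascent
... | no ¬ascent = inj₂ (inject₁ p , cong suc (toℕ-inject₁ p) ,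
  ≤∧≢⇒< (ℕ.≮⇒≥ ¬ascent) (suc≢inject₁ ∘ Injection.injective (↔⇒↣ w)))
  where
  suc≢inject₁ : Fin.suc p ≢ inject₁ p
  suc≢inject₁ eq = ℕ.1+n≢n (trans (cong toℕ eq) (toℕ-inject₁ p))

module _ {n} (w : Permutation′ n) where

  private
    w[_] : Fin n → Fin n
    w[ p ] = w ⟨$⟩ʳ p

  RunHead : Fin n → Fin n → Set
  RunHead r h = h ≤ r × RunStart w h × (∀ x → h ≤ x → x ≤ r → w[ r ] ≤ w[ x ])

  runHead : ∀ r → ∃ (RunHead r)
  runHead r = go r (<-wellFounded r)
    where
    go : ∀ r → Acc _<_ r → ∃ (RunHead r)
    go r (acc rec) with runStart⊎descent w r
    ... | inj₁ start = r , ≤-refl , start , λ x r≤x x≤r → ℕ.≤-reflexive (cong (toℕ ∘ w[_]) (≤-antisym r≤x x≤r))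
    ... | inj₂ (q , q⋖r , r-below-q) with go q (rec (⋖⇒< q⋖r))
    ...   | h , h≤q , start , q-min = h , ℕ.≤-trans h≤q (ℕ.<⇒≤ (⋖⇒< q⋖r)) , start , r-min
      where
      r-min : ∀ x → h ≤ x → x ≤ r → w[ r ] ≤ w[ x ]
      r-min x h≤x x≤r with x ≟ r
      ... | yes refl = ℕ.≤-refl
      ... | no x≢r   = ℕ.<⇒≤ (ℕ.<-≤-trans r-below-q (q-min x h≤x (⋖⇒≤ q⋖r (≤∧≢⇒< x≤r x≢r))))

  LeftToRightMax : Fin n → Set
  LeftToRightMax r = ∀ x → x < r → w[ x ] < w[ r ]

  leftToRightMax? : Decidable LeftToRightMax
  leftToRightMax? r = all? λ x → (x <? r) →-dec (w[ x ] <? w[ r ])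

  laterMax? : (p : Fin n) → Decidable (λ r → p < r × LeftToRightMax r)
  laterMax? p r = (p <? r) ×-dec leftToRightMax? r

  maximaAfter : Fin n → ℕ
  maximaAfter p = count (laterMax? p)

  maximaChain : Fin n → List (Fin n)
  maximaChain j = j ∷ filter (laterMax? j) (allFin n)

  length-maximaChain : ∀ j → length (maximaChain j) ≡ suc (maximaAfter j)
  length-maximaChain j = cong suc (length-filter-tabulate (laterMax? j) id)

  maximaChain-increasing : ∀ j → Linked (IncStep w) (maximaChain j)
  maximaChain-increasing j =
    Linked.map (λ { (a<b , _ , b-max) → a<b , b-max _ a<b }) (Linked-×-All sorted later)
    where
    later : All (λ r → j < r × LeftToRightMax r) (filter (laterMax? j) (allFin n))
    later = all-filter (laterMax? j) (allFin n)
    sorted : Linked _<_ (maximaChain j)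
    sorted = AllPairs⇒Linked (All.map proj₁ later ∷ AllPairs.filter⁺ (laterMax? j) (AllPairs.tabulate⁺-< id))

  upperClosure⇒laterNonMax : ∀ j p → InUpperClosure w j w[ p ] → j < p × ¬ LeftToRightMax p
  upperClosure⇒laterNonMax j p (i , j≤i , i<p′ , p-below-i) =
    ℕ.≤-<-trans j≤i i<p , λ p-max → ℕ.<-asym (p-max i i<p) p-below-i
    where
    i<p : i < p
    i<p = subst (i <_) (inverseˡ w) i<p′

  module _ (fireworks : Fireworks w) where

    runStart⇒leftToRightMax : ∀ {r} → RunStart w r → LeftToRightMax r
    runStart⇒leftToRightMax {r} start x x<r with runHead x
    ... | h , h≤x , h-start , x-min =
      ℕ.≤-<-trans (x-min h ≤-refl h≤x) (fireworks h r h-start start (ℕ.≤-<-trans h≤x x<r))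

    maximaAfter-decreasing : ∀ {p q} → IncStep w p q → maximaAfter q <ℕ maximaAfter p
    maximaAfter-decreasing {p} {q} (p<q , p-below-q) with runHead q
    ... | h , h≤q , h-start , q-min =
      count-<-mono (laterMax? q) (laterMax? p) (λ _ (q<r , r-max) → ℕ.<-trans p<q q<r , r-max)
        (p<h , runStart⇒leftToRightMax h-start) (λ (q<h , _) → ℕ.<⇒≱ q<h h≤q)
      where
      p<h : p < h
      p<h = ℕ.≰⇒> λ h≤p → ℕ.<⇒≱ p-below-q (q-min p h≤p (ℕ.<⇒≤ p<q))

    length-increasing≤ : ∀ {k ks} → Linked (IncStep w) (k ∷ ks) → length (k ∷ ks) ≤ℕ suc (maximaAfter k)
    length-increasing≤ [-]            = s≤s z≤n
    length-increasing≤ (step ∷ steps) = s≤s (ℕ.≤-trans (length-increasing≤ steps) (maximaAfter-decreasing step))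

    laterNonMax⇒upperClosure : ∀ j p → j < p × ¬ LeftToRightMax p → InUpperClosure w j w[ p ]
    laterNonMax⇒upperClosure j p (j<p , ¬p-max) with runStart⊎descent w p
    ... | inj₁ start                 = contradiction (runStart⇒leftToRightMax start) ¬p-max
    ... | inj₂ (q , q⋖p , p-below-q) =
      q , ⋖⇒≤ q⋖p j<p , subst (q <_) (sym (inverseˡ w)) (⋖⇒< q⋖p) , p-below-q

    wtUpperClosureRothe≡ : ∀ j → wtUpperClosureRothe w j ≡ (n ∸ toℕ j) ∸ suc (maximaAfter j)
    wtUpperClosureRothe≡ j = begin
      wtUpperClosureRothe w j                                ≡⟨ length-filter-tabulate (inUpperClosure? w j) id ⟩
      count (inUpperClosure? w j)                            ≡⟨ sym (count-permute (inUpperClosure? w j) w) ⟩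
      count (λ p → inUpperClosure? w j w[ p ])               ≡⟨ count-cong _ laterNonMax? (upperClosure⇒laterNonMax j) (laterNonMax⇒upperClosure j) ⟩
      count laterNonMax?                                     ≡⟨ sym (ℕ.m+n∸n≡m (count laterNonMax?) (maximaAfter j)) ⟩
      (count laterNonMax? + maximaAfter j) ∸ maximaAfter j   ≡⟨ cong (_∸ maximaAfter j) (count-split after? leftToRightMax?) ⟩
      count after? ∸ maximaAfter j                           ≡⟨ cong (_∸ maximaAfter j) (count-after j) ⟩
      (n ∸ suc (toℕ j)) ∸ maximaAfter j                      ≡⟨ ℕ.∸-+-assoc n (suc (toℕ j)) (maximaAfter j) ⟩
      n ∸ (suc (toℕ j) + maximaAfter j)                      ≡⟨ cong (n ∸_) (sym (ℕ.+-suc (toℕ j) (maximaAfter j))) ⟩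
      n ∸ (toℕ j + suc (maximaAfter j))                      ≡⟨ sym (ℕ.∸-+-assoc n (toℕ j) (suc (maximaAfter j))) ⟩
      (n ∸ toℕ j) ∸ suc (maximaAfter j)                      ∎
      where
      open ≡-Reasoning
      after? : Decidable (λ (p : Fin n) → j < p)
      after? p = j <? p
      laterNonMax? : Decidable (λ p → j < p × ¬ LeftToRightMax p)
      laterNonMax? p = (j <? p) ×-dec ¬? (leftToRightMax? p)

lemma3p13 : ∀ (n : ℕ) (w : Permutation′ n) → Fireworks w →
    ∀ (j : Fin n) → IsRajcodeEntry w j (wtUpperClosureRothe w j)
lemma3p13 n w fireworks j =
  maximaChain w j ,
  (refl , maximaChain-increasing w j) ,
  longest ,
  trans (wtUpperClosureRothe≡ w fireworks j) (cong ((n ∸ toℕ j) ∸_) (sym (length-maximaChain w j)))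
  where
  longest : ∀ t → IncSubseqFrom w j t → length t ≤ℕ length (maximaChain w j)
  longest (k ∷ ks) (refl , increasing) =
    subst (length (k ∷ ks) ≤ℕ_) (sym (length-maximaChain w j)) (length-increasing≤ w fireworks increasing)
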